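{- Suppose that $\Lambda$ is a directed partial order with no maximal element, $\mathcal S = \langle \langle S_u \mid u \in \Lambda \rangle, \mathcal R \rangle$ is a $\Lambda$-system with $\mathrm{width}(\mathcal S) = \theta < d_\Lambda$, and $\{b_i \mid i < \theta\}$ is a full set of branches in $\mathcal S$. Then there is $i < \theta$ such that $b_i$ is a cofinal branch in $\mathcal S$.
   Context: A partial order $\Lambda$ (order $\leq_\Lambda$, strict part $<_\Lambda$) is $\kappa$-directed if every subset of size $<\kappa$ has an upper bound; directed means $\aleph_0$-directed; $d_\Lambda$ is the largest $\kappa$ such that $\Lambda$ is $\kappa$-directed. For a binary relation $R$, write $x <_R y$ for $(x,y)\in R$ and $x \leq_R y$ for "$(x,y) \in R$ or $x = y$". A $\Lambda$-system is a structure $\mathcal S = \langle \langle S_u \mid u \in \Lambda\rangle, \mathcal R\rangle$ such that: (1) the $S_u$ are pairwise disjoint nonempty sets; let $S = \bigcup_u S_u$ and for $x \in S$ let $\ell(x)$ be the unique $u$ with $x \in S_u$; (2) $\mathcal R$ is a nonempty set of transitive binary relations on $S$; (3) for all $x,y \in S$, $R \in \mathcal R$, if $x <_R y$ then $\ell(x) <_\Lambda \ell(y)$; (4) for all $x,y,z \in S$ and $R \in \mathcal R$, if $x, y <_R z$ and $\ell(x) \leq_\Lambda \ell(y)$ then $x \leq_R y$; (5) for all $u <_\Lambda v$ there are $x \in S_u$, $y \in S_v$, $R \in \mathcal R$ with $x <_R y$. The width of $\mathcal S$ is $\max\{\sup\{|S_u| \mid u \in \Lambda\}, |\mathcal R|\}$.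 For $R \in \mathcal R$, $x,y\in S$ are $R$-compatible if there is $z \in S$ with $x,y \leq_R z$. A branch through $R$ is a set $b \subseteq S$ whose elements are pairwise $R$-compatible; a branch in $\mathcal S$ is a branch through some $R \in \mathcal R$; it is cofinal if $\{u \in \Lambda \mid b \cap S_u \neq \emptyset\}$ is cofinal in $\Lambda$. If $\mathrm{width}(\mathcal S) = \theta$, a full set of branches in $\mathcal S$ is a set $\{b_i \mid i < \theta\}$ where each $b_i$ is a branch in $\mathcal S$ and for every $u \in \Lambda$ there is $i<\theta$ with $b_i \cap S_u \neq \emptyset$. -}

module Defs where

open import Data.Product using (Σ; ∃; _×_; _,_)
open import Data.Sum using (_⊎_)
open import Data.Nat using (ℕ)
open import Data.Fin using (Fin)
open import Relation.Binary.PropositionalEquality using (_≡_; _≢_)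
open import Function.Bundles using (_↣_)

-- Cardinal comparison |A| ≤ |B| : an injection A → B.
_≤ᶜ_ : Set → Set → Set
A ≤ᶜ B = A ↣ B

module Order {Λ : Set} (_≤_ : Λ → Λ → Set) where

  _<_ : Λ → Λ → Set
  u < v = (u ≤ v) × (u ≢ v)

  HasUpperBound : (Λ → Set) → Set
  HasUpperBound X = ∃ λ u → ∀ v → X v → v ≤ u

  -- directed = ℵ₀-directed: every finite subset has an upper bound
  Directed : Set₁
  Directed = ∀ (n : ℕ) (X : Λ → Set) → Σ Λ X ≤ᶜ Fin n → HasUpperBound X

  NoMaximalElement : Set
  NoMaximalElement = ∀ u → ∃ λ v → u < v

  -- θ < d_Λ, where |Θ| = θ: Λ is θ⁺-directed, i.e. every subset of
  -- size ≤ θ has an upper bound.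
  BelowDirectedness : Set → Set₁
  BelowDirectedness Θ = ∀ (X : Λ → Set) → Σ Λ X ≤ᶜ Θ → HasUpperBound X

-- Λ-systems.  S is the disjoint union of the levels S_u, with ℓ x the
-- level of x; ℛ indexes the set of relations, R r being the relation r.
record LambdaSystem (Λ : Set) (_≤_ : Λ → Λ → Set) : Set₁ where
  open Order _≤_
  field
    S : Set
    ℓ : S → Λ
    levels-nonempty : ∀ u → ∃ λ x → ℓ x ≡ u
    ℛ : Set
    ℛ-nonempty : ℛ
    R : ℛ → S → S → Set
    R-trans : ∀ r {x y z} → R r x y → R r y z → R r x z
    R-level : ∀ r {x y} → R r x y → ℓ x < ℓ y
    R-tree : ∀ r {x y z} → R r x z → R r y z → ℓ x ≤ ℓ y → (R r x y ⊎ x ≡ y)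
    R-cover : ∀ {u v} → u < v →
      ∃ λ x → ∃ λ y → ∃ λ r → (ℓ x ≡ u) × (ℓ y ≡ v) × R r x y

  _≤[_]_ : S → ℛ → S → Set
  x ≤[ r ] y = R r x y ⊎ x ≡ y

  Level : Λ → Set
  Level u = Σ S λ x → ℓ x ≡ u

  -- width(𝒮) = |Θ| : |Θ| = max(sup_u |S_u|, |ℛ|), i.e. |Θ| is the least
  -- cardinal that is ≥ every |S_u| and ≥ |ℛ|.
  WidthIs : Set → Set₁
  WidthIs Θ = (∀ u → Level u ≤ᶜ Θ) × (ℛ ≤ᶜ Θ)
            × (∀ (K : Set) → (∀ u → Level u ≤ᶜ K) → ℛ ≤ᶜ K → Θ ≤ᶜ K)

  Compatible : ℛ → S → S → Set
  Compatible r x y = ∃ λ z → (x ≤[ r ] z) × (y ≤[ r ] z)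

  BranchThrough : ℛ → (S → Set) → Set
  BranchThrough r b = ∀ x y → b x → b y → Compatible r x y

  Branch : (S → Set) → Set
  Branch b = ∃ λ r → BranchThrough r b

  Cofinal : (S → Set) → Set
  Cofinal b = ∀ u → ∃ λ v → (u ≤ v) × (∃ λ x → b x × (ℓ x ≡ v))

  FullSetOfBranches : (Θ : Set) → (Θ → S → Set) → Set
  FullSetOfBranches Θ b = (∀ i → Branch (b i))
                        × (∀ u → ∃ λ i → ∃ λ x → b i x × (ℓ x ≡ u))

{-# OPTIONS --safe #-}

-- If no b_i were cofinal, each b_i would have a level u_i above which it
-- never meets S_v.  There are at most θ < d_Λ such levels, so they have a
-- common upper bound w; but S_w is met by some b_i, and w ≥ u_i.
-- Of the hypotheses only θ < d_Λ and the covering property of a full set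
-- of branches are needed.

module Submission where

open import Defs
open import Level using (0ℓ)
open import Axiom.ExcludedMiddle using (ExcludedMiddle)
open import Data.Empty using (⊥-elim)
open import Data.Product using (Σ; ∃; _×_; _,_; proj₁; proj₂)
open import Function.Bundles using (mk↣)
open import Relation.Binary.PropositionalEquality using (_≡_; refl)
open import Relation.Binary.Structures using (IsPartialOrder)
open import Relation.Nullary using (¬_; yes; no)

module _ {Λ : Set} (_≤_ : Λ → Λ → Set) where

  open Order _≤_

  ¬cofinal⇒eventually-absent : ExcludedMiddle 0ℓ → (P : Λ → Set) →
    ¬ (∀ u → ∃ λ v → (u ≤ v) × P v) →
    ∃ λ u → ∀ v → u ≤ v → ¬ P v
  ¬cofinal⇒eventually-absent em P ¬cofinal
    with em {∃ λ u → ∀ v → u ≤ v → ¬ P v}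
  ... | yes absent = absent
  ... | no ¬absent = ⊥-elim (¬cofinal cofinal)
    where
    cofinal : ∀ u → ∃ λ v → (u ≤ v) × P v
    cofinal u with em {∃ λ v → (u ≤ v) × P v}
    ... | yes above = above
    ... | no ¬above = ⊥-elim (¬absent (u , λ v u≤v pv → ¬above (v , u≤v , pv)))

  -- The range of f, as a subset of Λ, injects into Θ by picking a preimage.
  family-hasUpperBound : {Θ : Set} → BelowDirectedness Θ →
    (f : Θ → Λ) → ∃ λ w → ∀ i → f i ≤ w
  family-hasUpperBound below f =
    let w , bound = below Range (mk↣ {to = preimage} preimage-injective)
    in w , λ i → bound (f i) (i , refl)
    where
    Range : Λ → Set
    Range u = Σ _ λ i → f i ≡ u

    preimage : Σ Λ Range → _
    preimage (_ , i , _) = i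

    preimage-injective : ∀ {a c} → preimage a ≡ preimage c → a ≡ c
    preimage-injective {_ , i , refl} {_ , .i , refl} refl = refl

module _ {Λ : Set} {_≤_ : Λ → Λ → Set} (𝒮 : LambdaSystem Λ _≤_) where

  open LambdaSystem 𝒮
  open Order _≤_

  Meets : (S → Set) → Λ → Set
  Meets b v = ∃ λ x → b x × (ℓ x ≡ v)

  covering-family-has-cofinal-member : ExcludedMiddle 0ℓ → {Θ : Set} →
    BelowDirectedness Θ → (b : Θ → S → Set) →
    (∀ u → ∃ λ i → Meets (b i) u) → ∃ λ i → Cofinal (b i)
  covering-family-has-cofinal-member em below b covers
    with em {∃ λ i → Cofinal (b i)}
  ... | yes cofinal = cofinal
  ... | no ¬cofinal =
    let w , bound = family-hasUpperBound _≤_ below (λ i → proj₁ (escape i))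
        i , meets = covers w
    in ⊥-elim (proj₂ (escape i) w (bound i) meets)
    where
    escape : ∀ i → ∃ λ u → ∀ v → u ≤ v → ¬ Meets (b i) v
    escape i = ¬cofinal⇒eventually-absent _≤_ em (Meets (b i))
      (λ cofinal → ¬cofinal (i , cofinal))

proposition5p2 : ExcludedMiddle 0ℓ →
    (Λ : Set) (_≤_ : Λ → Λ → Set) → IsPartialOrder _≡_ _≤_ →
    Order.Directed _≤_ → Order.NoMaximalElement _≤_ →
    (𝒮 : LambdaSystem Λ _≤_) (Θ : Set) →
    LambdaSystem.WidthIs 𝒮 Θ → Order.BelowDirectedness _≤_ Θ →
    (b : Θ → LambdaSystem.S 𝒮 → Set) →
    LambdaSystem.FullSetOfBranches 𝒮 Θ b →
    ∃ λ i → LambdaSystem.Branch 𝒮 (b i) × LambdaSystem.Cofinal 𝒮 (b i)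
proposition5p2 em _ _≤_ _ _ _ 𝒮 _ _ below b (branches , covers) =
  let i , cofinal = covering-family-has-cofinal-member 𝒮 em below b covers
  in i , branches i , cofinal
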